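{- Let $b=2n+1\ge3$ and let $P(b)$ be the least positive integer with $2^{P(b)}\equiv\pm1\pmod b$. Build the system $IcoS(b)$ as follows. - Seeds: $a(b,1)=1$, and $a(b,i+1)$ is the smallest odd element of $RRS^*(b)$ that has not occurred as a $\hat j$ in any of the periods with seeds $a(b,1),\dots,a(b,i)$. - For seed $a=a(b,i)$, the period $IcoS(b,i)$ consists of the terms $R^{[k]}(2,2\cos(\pi a/b))=2\cos(\pi a2^k/b)$ for $k=1,\dots,P(b)$. Each term is written as $\pm2\cos(\pi\hat j/b)$ with $\hat j=\mathrm{mod}^*(a2^k,b)\in RRS^*(b)$. - Seeds are added until every element of $RRS^*(b)$ has occurred. Then $IcoS(b)$ consists of exactly $\varphi(b)/(2P(b))$ pairwise disjoint periods, each of length $P(b)$. Each $\hat j\in RRS^*(b)$ occurs exactly once among the terms $\pm2\cos(\pi\hat j/b)$ of all these periods.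
   Context: - $RRS^*(b)=\{r\in\mathbb Z:1\le r\le(b-1)/2,\ \gcd(r,b)=1\}$. - For $m$ coprime to $b$, $\mathrm{mod}^*(m,b)=\mathrm{mod}(m,b)$ if the least non-negative residue $\mathrm{mod}(m,b)$ is $\le b/2$, and $\mathrm{mod}^*(m,b)=\mathrm{mod}(-m,b)$ otherwise. - $R(2,x)=x^2-2$ and $R^{[k]}$ is its $k$-fold iterate. - $\varphi$ is Euler's totient function. -}

module Defs where

open import Data.Nat using (ℕ; zero; suc; _+_; _*_; _∸_; _^_; _≤_; _<_; _≤?_; _≟_; NonZero)
open import Data.Nat.DivMod using (_%_; _/_)
open import Data.Nat.GCD using (gcd)
open import Data.List using (List; []; _∷_; _++_; map; concatMap; filter; length; upTo; applyUpTo)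
open import Data.List.Membership.DecPropositional _≟_ using (_∈?_)
open import Data.List.Relation.Unary.All using (all?)
open import Data.List.Relation.Unary.Any using (any?)
open import Data.Maybe using (Maybe; just; nothing)
open import Data.Product using (_×_; _,_)
open import Relation.Nullary using (yes; no; ¬?)
open import Relation.Nullary.Decidable using (_×-dec_)
open import Relation.Binary.PropositionalEquality using (_≡_)

-- RRS*(b) = { r : 1 ≤ r ≤ (b-1)/2, gcd(r,b) = 1 }, listed increasingly.
-- (r ≤ (b-1)/2 is written 2r ≤ b-1; equivalent for integers r.)
RRS* : ℕ → List ℕ
RRS* b = filter (λ r → (1 ≤? r) ×-dec ((2 * r ≤? b ∸ 1) ×-dec (gcd r b ≟ 1))) (upTo b)

φ : ℕ → ℕ
φ b = length (filter (λ k → gcd k b ≟ 1) (applyUpTo suc b))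

-- mod*(m,b): least non-negative residue r = mod(m,b) if r ≤ b/2 (i.e. 2r ≤ b),
-- otherwise mod(-m,b) = b - r.
mod* : (m b : ℕ) → .{{NonZero b}} → ℕ
mod* m b with 2 * (m % b) ≤? b
... | yes _ = m % b
... | no  _ = b ∸ (m % b)

IsPeriodLength : (b P : ℕ) → .{{NonZero b}} → Set
IsPeriodLength b P = (1 ≤ P) × ((2 ^ P % b ≡ 1 % b) Data.Sum.⊎ (2 ^ P % b ≡ b ∸ 1))
  where import Data.Sum
  
IsLeastPeriodLength : (b P : ℕ) → .{{NonZero b}} → Set
IsLeastPeriodLength b P = IsPeriodLength b P × (∀ Q → IsPeriodLength b Q → P ≤ Q)

-- The period IcoS(b,i) with seed a: the indices ĵ = mod*(a 2^k, b), k = 1..P,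
-- of the terms 2cos(π a 2^k / b) = ±2cos(π ĵ / b).
period : (b P a : ℕ) → .{{NonZero b}} → List ℕ
period b P a = map (λ k → mod* (a * 2 ^ k) b) (applyUpTo suc P)

occurred : (b P : ℕ) → .{{NonZero b}} → List ℕ → List ℕ
occurred b P seeds = concatMap (λ a → period b P a) seeds

firstOddNew : (b P : ℕ) → .{{NonZero b}} → List ℕ → Maybe ℕ
firstOddNew b P seeds = go (RRS* b)
  where
  go : List ℕ → Maybe ℕ
  go [] = nothing
  go (r ∷ rs) with r % 2 ≟ 1 | r ∈? occurred b P seeds
  ... | yes _ | no _ = just r
  ... | _     | _    = go rs

-- Seed generation: starting from the current seed list, stop when every element
-- of RRS*(b) has occurred; otherwise append the smallest odd unoccurred element.
-- (fuel bounds the number of steps; b steps always suffice since each new seed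
-- contributes at least the new element itself.)
addSeeds : (b P : ℕ) → .{{NonZero b}} → ℕ → List ℕ → List ℕ
addSeeds b P zero seeds = seeds
addSeeds b P (suc fuel) seeds with all? (_∈? occurred b P seeds) (RRS* b)
... | yes _ = seeds
... | no  _ with firstOddNew b P seeds
...   | nothing = seeds
...   | just a  = addSeeds b P fuel (seeds ++ (a ∷ []))

seeds : (b P : ℕ) → .{{NonZero b}} → List ℕ
seeds b P = addSeeds b P b (1 ∷ [])

IcoS : (b P : ℕ) → .{{NonZero b}} → List (List ℕ)
IcoS b P = map (λ a → period b P a) (seeds b P)

{-# OPTIONS --safe #-}
module Submission where

-- Write x ≡± y for x ≡ ±y (mod b). The value mod*(x, b) is the unique representative of
-- the ≡±-class of x in 0..n, so the period with seed a lists the classes of a·2, …, a·2^P.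
-- Since 2^P ≡ ±1, the relation a ⇝ x (x ≡ ±a·2^j for some j) is an equivalence, and its
-- classes are exactly the periods; they have P distinct terms because P is least and units
-- cancel. Every class contains an odd element (the odd part of any member), so the seed
-- search stops only once RRS*(b) is covered, and a seed outside all earlier periods starts
-- a disjoint one. Finally k ↦ b − k shows φ(b) = 2|RRS*(b)|, giving φ(b)/(2P) periods.

open import Defs
open import Data.Nat using (ℕ; suc; _*_; _+_; _≤_)
open import Data.List using (List; length; concat)
open import Data.List.Relation.Unary.All using (All)
open import Data.List.Relation.Unary.AllPairs using (AllPairs)
open import Data.List.Membership.Propositional using (_∈_; _∉_)
open import Data.List.Relation.Binary.Permutation.Propositional using (_↭_)
open import Data.Product using (_×_)
open import Relation.Binary.PropositionalEquality using (_≡_)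

open import Level using (0ℓ)
open import Function.Base using (_∘_; case_of_)
open import Function.Bundles using (_⇔_; mk⇔)
open import Data.Empty using (⊥)
open import Data.Maybe using (Maybe; just; nothing)
open import Data.Product using (_,_; proj₁; proj₂; ∃-syntax; ∃₂)
open import Data.Sum using (_⊎_; inj₁; inj₂)
open import Data.Nat
  using (zero; _∸_; _^_; _<_; _≤?_; _≟_; NonZero; >-nonZero; >-nonZero⁻¹; z≤n; s≤s)
open import Data.Nat.Properties
open import Data.Nat.DivMod
open import Data.Nat.Divisibility
open import Data.Nat.GCD using (gcd)
open import Data.Nat.Coprimality using (Coprime; coprime-divisor; coprime⇒gcd≡1; gcd≡1⇒coprime)
import Data.Nat.Coprimality as Coprime
open import Data.Nat.Induction using (<-wellFounded)
open import Induction.WellFounded using (Acc; acc)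
open import Data.List using ([]; _∷_; _++_; [_]; map; filter; upTo; applyUpTo)
open import Data.List.Properties using (length-++; length-map; length-applyUpTo; length-filter; length-upTo)
open import Data.List.Relation.Unary.All as All using ([]; _∷_; all?)
open import Data.List.Relation.Unary.Any using (here; there)
open import Data.List.Relation.Unary.AllPairs as AllPairs using ([]; _∷_)
import Data.List.Relation.Unary.AllPairs.Properties as AllPairs
import Data.List.Relation.Unary.All.Properties as All
open import Data.List.Relation.Unary.Unique.Propositional using (Unique)
import Data.List.Relation.Unary.Unique.Propositional.Properties as Unique
open import Data.List.Relation.Binary.Subset.Propositional using (_⊆_)
open import Data.List.Relation.Binary.Disjoint.Propositional using (Disjoint)
open import Data.List.Membership.Propositional using (find; lose)
open import Data.List.Membership.Propositional.Properties
  using (∈-++⁺ˡ; ∈-++⁺ʳ; ∈-++⁻; ∈-map⁺; ∈-map⁻; ∈-filter⁺; ∈-filter⁻; ∈-upTo⁺;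
         ∈-applyUpTo⁺; ∈-applyUpTo⁻; ∈-concatMap⁺; ∈-concatMap⁻)
open import Data.List.Membership.Propositional.Properties.WithK using (unique∧set⇒bag)
open import Data.List.Relation.Binary.BagAndSetEquality using (∼bag⇒↭)
open import Data.List.Relation.Binary.Permutation.Propositional.Properties using (↭-length)
open import Data.List.Membership.DecPropositional _≟_ using (_∈?_)
open import Algebra.Properties.CommutativeSemigroup *-commutativeSemigroup using (x∙yz≈y∙xz)
open import Relation.Nullary using (¬_; yes; no; contradiction)
open import Relation.Nullary.Decidable using (_×-dec_)
open import Relation.Unary using (Decidable)
open import Relation.Binary using (Setoid; Reflexive; Symmetric; Transitive; DecidableEquality)
import Relation.Binary.Reasoning.Setoid
open import Relation.Binary.PropositionalEquality
  using (_≢_; refl; sym; trans; cong; cong₂; subst; module ≡-Reasoning)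

module _ {a} {A : Set a} where

  unique∧set⇒↭ : {xs ys : List A} → Unique xs → Unique ys →
                 (∀ {z} → z ∈ xs ⇔ z ∈ ys) → xs ↭ ys
  unique∧set⇒↭ xs! ys! xs⇔ys = ∼bag⇒↭ (unique∧set⇒bag xs! ys! xs⇔ys)

  length-concat-const : ∀ k {xss : List (List A)} →
                        All (λ xs → length xs ≡ k) xss → length (concat xss) ≡ length xss * k
  length-concat-const k []                   = refl
  length-concat-const k {xs ∷ _} (|xs| ∷ eqs) =
    trans (length-++ xs) (cong₂ _+_ |xs| (length-concat-const k eqs))

module _ {a b} {A : Set a} {B : Set b} {f : A → B} where

  map⁺-injectiveOn : ∀ {xs} → (∀ {x y} → x ∈ xs → y ∈ xs → f x ≡ f y → x ≡ y) →
                     Unique xs → Unique (map f xs)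
  map⁺-injectiveOn {[]}     _   []           = []
  map⁺-injectiveOn {x ∷ xs} inj (x∉xs ∷ xs!) =
    All.map⁺ (All.tabulate λ y∈xs → All.lookup x∉xs y∈xs ∘ inj (here refl) (there y∈xs))
    ∷ map⁺-injectiveOn (λ x∈ y∈ → inj (there x∈) (there y∈)) xs!

module Missing {a} {A : Set a} (_≟ᴬ_ : DecidableEquality A) where

  open import Data.List.Membership.DecPropositional _≟ᴬ_ using () renaming (_∈?_ to _∈ᴬ?_)

  missing : List A → List A → ℕ
  missing O []       = 0
  missing O (x ∷ xs) with x ∈ᴬ? O
  ... | yes _ = missing O xs
  ... | no  _ = suc (missing O xs)

  missing≤length : ∀ O xs → missing O xs ≤ length xs
  missing≤length O []       = z≤n
  missing≤length O (x ∷ xs) with x ∈ᴬ? O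
  ... | yes _ = m≤n⇒m≤1+n (missing≤length O xs)
  ... | no  _ = s≤s (missing≤length O xs)

  missing-antitone : ∀ {O O′} xs → O ⊆ O′ → missing O′ xs ≤ missing O xs
  missing-antitone []       _    = z≤n
  missing-antitone {O} {O′} (x ∷ xs) O⊆O′ with x ∈ᴬ? O | x ∈ᴬ? O′
  ... | yes x∈O | no x∉O′ = contradiction (O⊆O′ x∈O) x∉O′
  ... | yes _   | yes _   = missing-antitone xs O⊆O′
  ... | no _    | yes _   = m≤n⇒m≤1+n (missing-antitone xs O⊆O′)
  ... | no _    | no _    = s≤s (missing-antitone xs O⊆O′)

  missing-< : ∀ {O O′ y} xs → O ⊆ O′ → y ∈ xs → y ∉ O → y ∈ O′ →
              missing O′ xs < missing O xs
  missing-< {O} {O′} (x ∷ xs) O⊆O′ y∈ y∉O y∈O′ with x ∈ᴬ? O | x ∈ᴬ? O′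
  ... | yes x∈O | no x∉O′ = contradiction (O⊆O′ x∈O) x∉O′
  missing-< (x ∷ xs) O⊆O′ (here refl)  y∉O y∈O′ | yes x∈O | yes _ = contradiction x∈O y∉O
  missing-< (x ∷ xs) O⊆O′ (there y∈xs) y∉O y∈O′ | yes _   | yes _ =
    missing-< xs O⊆O′ y∈xs y∉O y∈O′
  missing-< (x ∷ xs) O⊆O′ (here refl)  y∉O y∈O′ | no _ | yes _   = s≤s (missing-antitone xs O⊆O′)
  missing-< (x ∷ xs) O⊆O′ (there y∈xs) y∉O y∈O′ | no _ | yes _   =
    m≤n⇒m≤1+n (missing-< xs O⊆O′ y∈xs y∉O y∈O′)
  missing-< (x ∷ xs) O⊆O′ (here refl)  y∉O y∈O′ | no _ | no x∉O′ = contradiction y∈O′ x∉O′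
  missing-< (x ∷ xs) O⊆O′ (there y∈xs) y∉O y∈O′ | no _ | no _    =
    s≤s (missing-< xs O⊆O′ y∈xs y∉O y∈O′)

  missing≡0⇒All∈ : ∀ {O} xs → missing O xs ≡ 0 → All (_∈ O) xs
  missing≡0⇒All∈         []       _ = []
  missing≡0⇒All∈ {O} (x ∷ xs) eq with x ∈ᴬ? O
  ... | yes x∈O = x∈O ∷ missing≡0⇒All∈ xs eq
  ... | no  _   = contradiction eq λ ()

open Missing _≟_

m%2≢1⇒m%2≡0 : ∀ m → m % 2 ≢ 1 → m % 2 ≡ 0
m%2≢1⇒m%2≡0 m with m % 2 | m%n<n m 2
... | 0           | _               = λ _ → refl
... | 1           | _               = λ ≢1 → contradiction refl ≢1
... | suc (suc _) | s≤s (s≤s ())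

odd-part : ∀ r → 1 ≤ r → ∃₂ λ o e → o % 2 ≡ 1 × o * 2 ^ e ≡ r
odd-part r 1≤r = go r 1≤r (<-wellFounded r)
  where
  go : ∀ r → 1 ≤ r → Acc _<_ r → ∃₂ λ o e → o % 2 ≡ 1 × o * 2 ^ e ≡ r
  go r 1≤r (acc rec) with r % 2 ≟ 1
  ... | yes odd = r , 0 , odd , *-identityʳ r
  ... | no  r%2≢1 with m%n≡0⇒n∣m r 2 (m%2≢1⇒m%2≡0 r r%2≢1)
  ...   | divides q refl with go q 1≤q (rec q<2q)
    where
    1≤q : 1 ≤ q
    1≤q = n≢0⇒n>0 λ { refl → contradiction 1≤r λ () }
    q<2q : q < q * 2
    q<2q = m<m*n q 2 {{>-nonZero 1≤q}} (s≤s (s≤s z≤n))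
  ...     | o , e , odd , o2^e≡q = o , suc e , odd , (begin
    o * (2 * 2 ^ e) ≡⟨ cong (o *_) (*-comm 2 (2 ^ e)) ⟩
    o * (2 ^ e * 2) ≡⟨ *-assoc o (2 ^ e) 2 ⟨
    o * 2 ^ e * 2   ≡⟨ cong (_* 2) o2^e≡q ⟩
    q * 2           ∎)
    where open ≡-Reasoning

coprime-* : ∀ {x y m} → Coprime x m → Coprime y m → Coprime (x * y) m
coprime-* {x} cx cy (d∣xy , d∣m) = cy (coprime-divisor d⊥x d∣xy , d∣m)
  where
  d⊥x : Coprime _ x
  d⊥x (e∣d , e∣x) = cx (e∣x , ∣-trans e∣d d∣m)

coprime-∣ : ∀ {d x m} → d ∣ x → Coprime x m → Coprime d m
coprime-∣ d∣x cx (e∣d , e∣m) = cx (∣-trans e∣d d∣x , e∣m)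

coprime-∸ : ∀ {r m} → r ≤ m → Coprime r m → Coprime (m ∸ r) m
coprime-∸ {r} {m} r≤m cr (d∣m∸r , d∣m) =
  cr (subst (_ ∣_) (m∸[m∸n]≡n r≤m) (∣m∣n⇒∣m∸n d∣m d∣m∸r) , d∣m)
  where
  ∣m∣n⇒∣m∸n : ∀ {d m n} → d ∣ m → d ∣ n → d ∣ m ∸ n
  ∣m∣n⇒∣m∸n {n = n} (divides p refl) (divides q refl) =
    divides (p ∸ q) (sym (*-distribʳ-∸ _ p q))

-- Congruence up to sign

module SignedCongruence (m : ℕ) .{{_ : NonZero m}} where

  -- A data type rather than a sum, so that x and y can be inferred from x ≡± y.
  infix 4 _≡±_
  data _≡±_ (x y : ℕ) : Set where
    ≡⁺ : x % m ≡ y % m → x ≡± y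
    ≡⁻ : (x + y) % m ≡ 0 → x ≡± y

  ≡⇒≡± : ∀ {x y} → x ≡ y → x ≡± y
  ≡⇒≡± refl = ≡⁺ refl

  ≡±-refl : Reflexive _≡±_
  ≡±-refl = ≡⁺ refl

  ≡±-sym : Symmetric _≡±_
  ≡±-sym         (≡⁺ eq) = ≡⁺ (sym eq)
  ≡±-sym {x} {y} (≡⁻ eq) = ≡⁻ (trans (cong (_% m) (+-comm y x)) eq)

  ≡±-trans : Transitive _≡±_
  ≡±-trans (≡⁺ p) (≡⁺ q) = ≡⁺ (trans p q)
  ≡±-trans {x} {y} {z} (≡⁺ p) (≡⁻ q) = ≡⁻ (begin
    (x + z) % m           ≡⟨ %-distribˡ-+ x z m ⟩
    (x % m + z % m) % m   ≡⟨ cong (λ t → (t + z % m) % m) p ⟩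
    (y % m + z % m) % m   ≡⟨ %-distribˡ-+ y z m ⟨
    (y + z) % m           ≡⟨ q ⟩
    0                     ∎)
    where open ≡-Reasoning
  ≡±-trans (≡⁻ p) (≡⁺ q) = ≡±-sym (≡±-trans (≡⁺ (sym q)) (≡±-sym (≡⁻ p)))
  ≡±-trans {x} {y} {z} (≡⁻ p) (≡⁻ q) = ≡⁺ (begin
    x % m             ≡⟨ %-remove-+ʳ x (m%n≡0⇒n∣m (y + z) m q) ⟨
    (x + (y + z)) % m ≡⟨ cong (_% m) (+-assoc x y z) ⟨
    (x + y + z) % m   ≡⟨ %-remove-+ˡ z (m%n≡0⇒n∣m (x + y) m p) ⟩
    z % m             ∎)
    where open ≡-Reasoning

  ≡±-setoid : Setoid 0ℓ 0ℓ
  ≡±-setoid = record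
    { _≈_           = _≡±_
    ; isEquivalence = record { refl = ≡±-refl ; sym = ≡±-sym ; trans = ≡±-trans }
    }

  module ≡±-Reasoning = Relation.Binary.Reasoning.Setoid ≡±-setoid

  ≡±-*ʳ : ∀ c {x y} → x ≡± y → x * c ≡± y * c
  ≡±-*ʳ c {x} {y} (≡⁺ eq) = ≡⁺ (begin
    (x * c) % m               ≡⟨ %-distribˡ-* x c m ⟩
    ((x % m) * (c % m)) % m   ≡⟨ cong (λ t → (t * (c % m)) % m) eq ⟩
    ((y % m) * (c % m)) % m   ≡⟨ %-distribˡ-* y c m ⟨
    (y * c) % m               ∎)
    where open ≡-Reasoning
  ≡±-*ʳ c {x} {y} (≡⁻ eq) = ≡⁻ (begin
    (x * c + y * c) % m ≡⟨ cong (_% m) (*-distribʳ-+ c x y) ⟨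
    ((x + y) * c) % m   ≡⟨ n∣m⇒m%n≡0 _ m (∣m⇒∣m*n c (m%n≡0⇒n∣m (x + y) m eq)) ⟩
    0                   ∎)
    where open ≡-Reasoning

  ≡±-* : ∀ {x y u v} → x ≡± y → u ≡± v → x * u ≡± y * v
  ≡±-* {x} {y} {u} {v} x≡±y u≡±v = begin
    x * u ≈⟨ ≡±-*ʳ u x≡±y ⟩
    y * u ≡⟨ *-comm y u ⟩
    u * y ≈⟨ ≡±-*ʳ y u≡±v ⟩
    v * y ≡⟨ *-comm v y ⟩
    y * v ∎
    where open ≡±-Reasoning

  ≡±-^ : ∀ {c} q → c ≡± 1 → c ^ q ≡± 1
  ≡±-^ zero    _    = ≡±-refl
  ≡±-^ (suc q) c≡±1 = ≡±-* c≡±1 (≡±-^ q c≡±1)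

  ≡±0⇒∣ : ∀ {x} → x ≡± 0 → m ∣ x
  ≡±0⇒∣ {x} (≡⁺ eq) = m%n≡0⇒n∣m x m (trans eq (m*n%n≡0 0 m))
  ≡±0⇒∣ {x} (≡⁻ eq) = m%n≡0⇒n∣m x m (trans (cong (_% m) (sym (+-identityʳ x))) eq)

  ±1-residue⇒≡±1 : ∀ {c} → c % m ≡ 1 % m ⊎ c % m ≡ m ∸ 1 → c ≡± 1
  ±1-residue⇒≡±1     (inj₁ eq) = ≡⁺ eq
  ±1-residue⇒≡±1 {c} (inj₂ eq) = ≡⁻ (begin
    (c + 1) % m               ≡⟨ %-distribˡ-+ c 1 m ⟩
    (c % m + 1 % m) % m       ≡⟨ cong (λ t → (t + 1 % m) % m) eq′ ⟩
    ((m ∸ 1) % m + 1 % m) % m ≡⟨ %-distribˡ-+ (m ∸ 1) 1 m ⟨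
    (m ∸ 1 + 1) % m           ≡⟨ cong (_% m) (m∸n+n≡m (>-nonZero⁻¹ m)) ⟩
    m % m                     ≡⟨ n%n≡0 m ⟩
    0                         ∎)
    where
    open ≡-Reasoning
    eq′ : c % m ≡ (m ∸ 1) % m
    eq′ = trans eq (sym (m<n⇒m%n≡m (∸-monoʳ-< {o = 0} (s≤s z≤n) (>-nonZero⁻¹ m))))

  ≡±1⇒±1-residue : ∀ {c} → c ≡± 1 → c % m ≡ 1 % m ⊎ c % m ≡ m ∸ 1
  ≡±1⇒±1-residue     (≡⁺ eq) = inj₁ eq
  ≡±1⇒±1-residue {c} (≡⁻ eq) = inj₂ (%-pred-≡0 (trans (cong (_% m) (+-comm 1 c)) eq))

  coprime-resp-≡± : ∀ {x y} → Coprime x m → y ≡± x → Coprime y m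
  coprime-resp-≡± cx (≡⁺ eq) (d∣y , d∣m) =
    cx (∣n∣m%n⇒∣m d∣m (subst (_ ∣_) eq (%-presˡ-∣ d∣y d∣m)) , d∣m)
  coprime-resp-≡± {x} {y} cx (≡⁻ eq) (d∣y , d∣m) =
    cx (∣m+n∣m⇒∣n (∣-trans d∣m (m%n≡0⇒n∣m (y + x) m eq)) d∣y , d∣m)

  %≡%⇒∣∸ : ∀ x y → x % m ≡ y % m → m ∣ y ∸ x
  %≡%⇒∣∸ x y eq = divides (y / m ∸ x / m) (begin
    y ∸ x                                     ≡⟨ cong₂ _∸_ (m≡m%n+[m/n]*n y m) x≡ ⟩
    (y % m + y / m * m) ∸ (y % m + x / m * m) ≡⟨ [m+n]∸[m+o]≡n∸o (y % m) _ _ ⟩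
    y / m * m ∸ x / m * m                     ≡⟨ *-distribʳ-∸ m (y / m) (x / m) ⟨
    (y / m ∸ x / m) * m                       ∎)
    where
    open ≡-Reasoning
    x≡ : x ≡ y % m + x / m * m
    x≡ = trans (m≡m%n+[m/n]*n x m) (cong (_+ x / m * m) eq)

  coprime-cancel : ∀ {x c} → Coprime x m → 1 ≤ c → x * c ≡± x → c ≡± 1
  coprime-cancel {x} {c} cx 1≤c (≡⁺ eq) = ≡⁺ (begin
    c % m             ≡⟨ cong (_% m) (m∸n+n≡m 1≤c) ⟨
    (c ∸ 1 + 1) % m   ≡⟨ %-remove-+ˡ 1 (coprime-divisor (Coprime.sym cx) m∣x[c∸1]) ⟩
    1 % m             ∎)
    where
    open ≡-Reasoning
    m∣x[c∸1] : m ∣ x * (c ∸ 1)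
    m∣x[c∸1] = subst (m ∣_) (sym (trans (*-distribˡ-∸ x c 1) (cong (x * c ∸_) (*-identityʳ x))))
                 (%≡%⇒∣∸ x (x * c) (sym eq))
  coprime-cancel {x} {c} cx _ (≡⁻ eq) =
    ≡⁻ (n∣m⇒m%n≡0 (c + 1) m (subst (m ∣_) (+-comm 1 c) m∣1+c))
    where
    m∣1+c : m ∣ suc c
    m∣1+c = coprime-divisor (Coprime.sym cx)
              (subst (m ∣_) (trans (+-comm (x * c) x) (sym (*-suc x c))) (m%n≡0⇒n∣m _ m eq))

module OddModulus (n : ℕ) where

  b : ℕ
  b = suc (2 * n)

  open SignedCongruence b public

  ≤n⇒<b : ∀ {r} → r ≤ n → r < b
  ≤n⇒<b r≤n = s≤s (≤-trans r≤n (m≤m+n n (n + 0)))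

  2*≤b⇒≤n : ∀ {r} → 2 * r ≤ b → r ≤ n
  2*≤b⇒≤n {r} 2r≤b = ≤-pred (*-cancelˡ-< 2 r (suc n) (subst (2 * r <_) (sym (*-suc 2 n)) (s≤s 2r≤b)))

  b∸[1+n]≡n : b ∸ suc n ≡ n
  b∸[1+n]≡n = trans (m+n∸m≡n n (n + 0)) (+-identityʳ n)

  b∸n≡1+n : b ∸ n ≡ suc n
  b∸n≡1+n = trans (+-∸-assoc 1 (m≤m+n n (n + 0))) (cong suc (b∸[1+n]≡n))

  n<r⇒b∸r≤n : ∀ {r} → n < r → b ∸ r ≤ n
  n<r⇒b∸r≤n n<r = ≤-trans (∸-monoʳ-≤ b n<r) (≤-reflexive b∸[1+n]≡n)

  r≤n⇒n<b∸r : ∀ {r} → r ≤ n → n < b ∸ r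
  r≤n⇒n<b∸r r≤n = ≤-trans (≤-reflexive (sym b∸n≡1+n)) (∸-monoʳ-≤ b r≤n)

  b<2*⇒b∸≤n : ∀ {r} → b < 2 * r → b ∸ r ≤ n
  b<2*⇒b∸≤n {r} b<2r = n<r⇒b∸r≤n n<r
    where
    n<r : n < r
    n<r = *-cancelˡ-≤ 2 (subst (_≤ 2 * r) (sym (*-suc 2 n)) b<2r)

  mod*≤n : ∀ x → mod* x b ≤ n
  mod*≤n x with 2 * (x % b) ≤? b
  ... | yes 2r≤b = 2*≤b⇒≤n 2r≤b
  ... | no  2r≰b = b<2*⇒b∸≤n {x % b} (≰⇒> 2r≰b)

  mod*≡± : ∀ x → mod* x b ≡± x
  mod*≡± x with 2 * (x % b) ≤? b
  ... | yes _ = ≡⁺ (m%n%n≡m%n x b)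
  ... | no  _ = ≡±-trans (≡⁻ b∸r+r≡0) (≡⁺ (m%n%n≡m%n x b))
    where
    b∸r+r≡0 : (b ∸ x % b + x % b) % b ≡ 0
    b∸r+r≡0 = trans (cong (_% b) (m∸n+n≡m (<⇒≤ (m%n<n x b)))) (n%n≡0 b)

  ≡±-unique-≤n : ∀ {r s} → r ≤ n → s ≤ n → r ≡± s → r ≡ s
  ≡±-unique-≤n r≤n s≤n (≡⁺ eq) =
    trans (sym (m<n⇒m%n≡m (≤n⇒<b r≤n))) (trans eq (m<n⇒m%n≡m (≤n⇒<b s≤n)))
  ≡±-unique-≤n {r} {s} r≤n s≤n (≡⁻ eq) =
    trans (m+n≡0⇒m≡0 r r+s≡0) (sym (m+n≡0⇒n≡0 r r+s≡0))
    where
    r+s<b : r + s < b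
    r+s<b = s≤s (≤-trans (+-mono-≤ r≤n s≤n) (≤-reflexive (cong (n +_) (sym (+-identityʳ n)))))
    r+s≡0 : r + s ≡ 0
    r+s≡0 = trans (sym (m<n⇒m%n≡m r+s<b)) eq

  mod*-cong : ∀ {x y} → x ≡± y → mod* x b ≡ mod* y b
  mod*-cong {x} {y} x≡±y = ≡±-unique-≤n (mod*≤n x) (mod*≤n y) (begin
    mod* x b ≈⟨ mod*≡± x ⟩
    x        ≈⟨ x≡±y ⟩
    y        ≈⟨ mod*≡± y ⟨
    mod* y b ∎)
    where open ≡±-Reasoning

  mod*-injective : ∀ {x y} → mod* x b ≡ mod* y b → x ≡± y
  mod*-injective {x} {y} eq = begin
    x        ≈⟨ mod*≡± x ⟨
    mod* x b ≡⟨ eq ⟩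
    mod* y b ≈⟨ mod*≡± y ⟩
    y        ∎
    where open ≡±-Reasoning

  mod*-id : ∀ {r} → r ≤ n → mod* r b ≡ r
  mod*-id {r} r≤n = ≡±-unique-≤n (mod*≤n r) r≤n (mod*≡± r)

  coprime-2^ : ∀ k → Coprime (2 ^ k) b
  coprime-2^ zero    (d∣1 , _)   = ∣1⇒≡1 d∣1
  coprime-2^ (suc k) = coprime-* coprime-2 (coprime-2^ k)
    where
    coprime-2 : Coprime 2 b
    coprime-2 {d} (d∣2 , d∣b) =
      ∣1⇒≡1 (∣m+n∣m⇒∣n (subst (d ∣_) (+-comm 1 (2 * n)) d∣b) (∣-trans d∣2 (m∣m*n n)))

  reduced? : Decidable (λ r → 1 ≤ r × 2 * r ≤ b ∸ 1 × gcd r b ≡ 1)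
  reduced? r = (1 ≤? r) ×-dec ((2 * r ≤? b ∸ 1) ×-dec (gcd r b ≟ 1))

  ∈RRS*⁺ : ∀ {r} → 1 ≤ r → r ≤ n → Coprime r b → r ∈ RRS* b
  ∈RRS*⁺ 1≤r r≤n cop =
    ∈-filter⁺ reduced? (∈-upTo⁺ (≤n⇒<b r≤n)) (1≤r , *-monoʳ-≤ 2 r≤n , coprime⇒gcd≡1 cop)

  ∈RRS*⁻ : ∀ {r} → r ∈ RRS* b → 1 ≤ r × r ≤ n × Coprime r b
  ∈RRS*⁻ r∈ with (1≤r , 2r≤2n , gcd≡1) ← proj₂ (∈-filter⁻ reduced? {xs = upTo b} r∈) =
    1≤r , *-cancelˡ-≤ 2 2r≤2n , gcd≡1⇒coprime gcd≡1

  ∈RRS*⇒≤n : ∀ {r} → r ∈ RRS* b → r ≤ n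
  ∈RRS*⇒≤n = proj₁ ∘ proj₂ ∘ ∈RRS*⁻

  RRS*-unique : Unique (RRS* b)
  RRS*-unique = Unique.filter⁺ reduced? (Unique.upTo⁺ b)

  module _ (n≥1 : 1 ≤ n) where

    ¬coprime[b,b] : ¬ Coprime b b
    ¬coprime[b,b] cop = <⇒≢ n≥1 (sym (m+n≡0⇒m≡0 n (suc-injective (cop (∣-refl , ∣-refl)))))

    mod*∈RRS* : ∀ {x} → Coprime x b → mod* x b ∈ RRS* b
    mod*∈RRS* {x} cop = ∈RRS*⁺ (n≢0⇒n>0 mod*≢0) (mod*≤n x) (coprime-resp-≡± cop (mod*≡± x))
      where
      mod*≢0 : mod* x b ≢ 0
      mod*≢0 eq = ¬coprime[b,b] λ (d∣b , _) → cop (∣-trans d∣b b∣x , d∣b)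
        where
        b∣x : b ∣ x
        b∣x = ≡±0⇒∣ (≡±-sym (subst (_≡± x) eq (mod*≡± x)))

    1∈RRS* : 1 ∈ RRS* b
    1∈RRS* = ∈RRS*⁺ ≤-refl n≥1 (Coprime.1-coprimeTo b)

    coprime? : Decidable (λ k → gcd k b ≡ 1)
    coprime? k = gcd k b ≟ 1

    coprimes : List ℕ
    coprimes = filter coprime? (applyUpTo suc b)

    ∈coprimes⁺ : ∀ {k} → 1 ≤ k → k ≤ b → Coprime k b → k ∈ coprimes
    ∈coprimes⁺ (s≤s z≤n) k≤b cop = ∈-filter⁺ coprime? (∈-applyUpTo⁺ suc k≤b) (coprime⇒gcd≡1 cop)

    ∈coprimes⁻ : ∀ {k} → k ∈ coprimes → 1 ≤ k × k < b × Coprime k b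
    ∈coprimes⁻ k∈ with k∈range , gcd≡1 ← ∈-filter⁻ coprime? {xs = applyUpTo suc b} k∈
                 with i , i<b , refl ← ∈-applyUpTo⁻ suc k∈range =
      s≤s z≤n , ≤∧≢⇒< i<b k≢b , gcd≡1⇒coprime gcd≡1
      where
      k≢b : suc i ≢ b
      k≢b refl = ¬coprime[b,b] (gcd≡1⇒coprime gcd≡1)

    mirrored : List ℕ
    mirrored = map (b ∸_) (RRS* b)

    coprimes↭RRS*++mirrored : coprimes ↭ RRS* b ++ mirrored
    coprimes↭RRS*++mirrored = unique∧set⇒↭ coprimes-unique
      (Unique.++⁺ RRS*-unique mirrored-unique disjoint) (mk⇔ to from)
      where
      coprimes-unique : Unique coprimes
      coprimes-unique = Unique.filter⁺ coprime? (Unique.applyUpTo⁺₁ suc b λ i<j _ → <⇒≢ (s≤s i<j))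

      mirrored-unique : Unique mirrored
      mirrored-unique = map⁺-injectiveOn
        (λ r∈ s∈ → ∸-cancelˡ-≡ (<⇒≤ (≤n⇒<b (∈RRS*⇒≤n r∈))) (<⇒≤ (≤n⇒<b (∈RRS*⇒≤n s∈))))
        RRS*-unique

      disjoint : Disjoint (RRS* b) mirrored
      disjoint (r∈ , r∈mirrored) with s , s∈ , refl ← ∈-map⁻ (b ∸_) r∈mirrored =
        <⇒≱ (r≤n⇒n<b∸r (∈RRS*⇒≤n s∈)) (∈RRS*⇒≤n r∈)

      to : ∀ {k} → k ∈ coprimes → k ∈ RRS* b ++ mirrored
      to {k} k∈ with 1≤k , k<b , cop ← ∈coprimes⁻ k∈ with k ≤? n
      ... | yes k≤n = ∈-++⁺ˡ (∈RRS*⁺ 1≤k k≤n cop)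
      ... | no  k≰n = ∈-++⁺ʳ (RRS* b) (subst (_∈ mirrored) (m∸[m∸n]≡n (<⇒≤ k<b))
            (∈-map⁺ (b ∸_) (∈RRS*⁺ (m<n⇒0<n∸m k<b) (n<r⇒b∸r≤n (≰⇒> k≰n)) (coprime-∸ (<⇒≤ k<b) cop))))

      from : ∀ {k} → k ∈ RRS* b ++ mirrored → k ∈ coprimes
      from k∈ with ∈-++⁻ (RRS* b) k∈
      ... | inj₁ k∈RRS* with 1≤k , k≤n , cop ← ∈RRS*⁻ k∈RRS* =
        ∈coprimes⁺ 1≤k (<⇒≤ (≤n⇒<b k≤n)) cop
      ... | inj₂ k∈mirrored with r , r∈ , refl ← ∈-map⁻ (b ∸_) k∈mirrored
                            with _ , r≤n , cop ← ∈RRS*⁻ r∈ =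
        ∈coprimes⁺ (m<n⇒0<n∸m (≤n⇒<b r≤n)) (m∸n≤m b r) (coprime-∸ (<⇒≤ (≤n⇒<b r≤n)) cop)

    φ≡2*|RRS*| : φ b ≡ 2 * length (RRS* b)
    φ≡2*|RRS*| = begin
      φ b                               ≡⟨ ↭-length coprimes↭RRS*++mirrored ⟩
      length (RRS* b ++ mirrored)       ≡⟨ length-++ (RRS* b) ⟩
      length (RRS* b) + length mirrored ≡⟨ cong (length (RRS* b) +_) (length-map (b ∸_) (RRS* b)) ⟩
      length (RRS* b) + length (RRS* b) ≡⟨ cong (length (RRS* b) +_) (+-identityʳ _) ⟨
      2 * length (RRS* b)               ∎
      where open ≡-Reasoning

-- Doubling orbits and periods

module Periods (n p : ℕ) (n≥1 : 1 ≤ n) (least : IsLeastPeriodLength (suc (2 * n)) (suc p)) where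

  open OddModulus n

  P : ℕ
  P = suc p

  2^P≡±1 : 2 ^ P ≡± 1
  2^P≡±1 = ±1-residue⇒≡±1 (proj₂ (proj₁ least))

  *2^-+ : ∀ x i j → x * 2 ^ (i + j) ≡ x * 2 ^ i * 2 ^ j
  *2^-+ x i j = trans (cong (x *_) (^-distribˡ-+-* 2 i j)) (sym (*-assoc x (2 ^ i) (2 ^ j)))

  *2^[q*P]≡± : ∀ x q → x * 2 ^ (q * P) ≡± x
  *2^[q*P]≡± x q = begin
    x * 2 ^ (q * P)   ≡⟨ cong (λ e → x * 2 ^ e) (*-comm q P) ⟩
    x * 2 ^ (P * q)   ≡⟨ cong (x *_) (^-*-assoc 2 P q) ⟨
    x * (2 ^ P) ^ q   ≈⟨ ≡±-* (≡±-refl {x}) (≡±-^ q 2^P≡±1) ⟩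
    x * 1             ≡⟨ *-identityʳ x ⟩
    x                 ∎
    where open ≡±-Reasoning

  period-exponent : ∀ j → suc ((j + p) % P) + (j + p) / P * P ≡ j + 1 * P
  period-exponent j = begin
    suc ((j + p) % P + (j + p) / P * P) ≡⟨ cong suc (m≡m%n+[m/n]*n (j + p) P) ⟨
    suc (j + p)                         ≡⟨ +-suc j p ⟨
    j + P                               ≡⟨ cong (j +_) (+-identityʳ P) ⟨
    j + 1 * P                           ∎
    where open ≡-Reasoning

  infix 4 _⇝_
  record _⇝_ (a x : ℕ) : Set where
    constructor reach
    field
      exponent : ℕ
      ≡±-power : x ≡± a * 2 ^ exponent

  ⇝-refl : Reflexive _⇝_
  ⇝-refl {a} = reach 0 (≡⇒≡± (sym (*-identityʳ a)))

  ⇝-trans : Transitive _⇝_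
  ⇝-trans {a} {x} {y} (reach j x≡±) (reach l y≡±) = reach (j + l) (begin
    y                   ≈⟨ y≡± ⟩
    x * 2 ^ l           ≈⟨ ≡±-*ʳ (2 ^ l) x≡± ⟩
    a * 2 ^ j * 2 ^ l   ≡⟨ *2^-+ a j l ⟨
    a * 2 ^ (j + l)     ∎)
    where open ≡±-Reasoning

  ⇝-sym : Symmetric _⇝_
  ⇝-sym {a} {x} (reach j x≡±) = reach (p * j) (begin
    a                       ≈⟨ *2^[q*P]≡± a j ⟨
    a * 2 ^ (j * P)         ≡⟨ cong (λ e → a * 2 ^ e) (*-comm j P) ⟩
    a * 2 ^ (j + p * j)     ≡⟨ *2^-+ a j (p * j) ⟩
    a * 2 ^ j * 2 ^ (p * j) ≈⟨ ≡±-*ʳ (2 ^ (p * j)) x≡± ⟨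
    x * 2 ^ (p * j)         ∎)
    where open ≡±-Reasoning

  -- Shifting j by one period before reducing mod P puts the exponent in 1..P, not 0..P-1.
  ⇝-reduce : ∀ {a x} → a ⇝ x → ∃[ i ] i < P × x ≡± a * 2 ^ suc i
  ⇝-reduce {a} {x} (reach j x≡±) = i , m%n<n (j + p) P , (begin
    x                           ≈⟨ x≡± ⟩
    a * 2 ^ j                   ≈⟨ *2^[q*P]≡± (a * 2 ^ j) 1 ⟨
    a * 2 ^ j * 2 ^ (1 * P)     ≡⟨ *2^-+ a j (1 * P) ⟨
    a * 2 ^ (j + 1 * P)         ≡⟨ cong (λ e → a * 2 ^ e) (period-exponent j) ⟨
    a * 2 ^ (suc i + q * P)     ≡⟨ *2^-+ a (suc i) (q * P) ⟩
    a * 2 ^ suc i * 2 ^ (q * P) ≈⟨ *2^[q*P]≡± (a * 2 ^ suc i) q ⟩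
    a * 2 ^ suc i               ∎)
    where
    open ≡±-Reasoning
    i q : ℕ
    i = (j + p) % P
    q = (j + p) / P

  ∈period⁻ : ∀ {a x} → x ∈ period b P a → ∃[ i ] i < P × x ≡ mod* (a * 2 ^ suc i) b
  ∈period⁻ {a} x∈ with k , k∈ , refl ← ∈-map⁻ (λ k → mod* (a * 2 ^ k) b) x∈
                  with i , i<P , refl ← ∈-applyUpTo⁻ suc k∈ = i , i<P , refl

  ∈period⁺ : ∀ {a i} → i < P → mod* (a * 2 ^ suc i) b ∈ period b P a
  ∈period⁺ {a} i<P = ∈-map⁺ (λ k → mod* (a * 2 ^ k) b) (∈-applyUpTo⁺ suc i<P)

  ∈period⇒⇝ : ∀ {a x} → x ∈ period b P a → a ⇝ x
  ∈period⇒⇝ {a} x∈ with i , _ , refl ← ∈period⁻ {a} x∈ = reach (suc i) (mod*≡± (a * 2 ^ suc i))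

  ⇝⇒∈period : ∀ {a x} → x ≤ n → a ⇝ x → x ∈ period b P a
  ⇝⇒∈period {a} {x} x≤n a⇝x with i , i<P , x≡± ← ⇝-reduce a⇝x =
    subst (_∈ period b P a) (trans (mod*-cong (≡±-sym x≡±)) (mod*-id x≤n)) (∈period⁺ {a} i<P)

  length-period : ∀ a → length (period b P a) ≡ P
  length-period a = trans (length-map _ (applyUpTo suc P)) (length-applyUpTo suc P)

  period⊆RRS* : ∀ {a} → Coprime a b → period b P a ⊆ RRS* b
  period⊆RRS* {a} cop x∈ with i , _ , refl ← ∈period⁻ {a} x∈ =
    mod*∈RRS* n≥1 (coprime-* cop (coprime-2^ (suc i)))

  period-unique : ∀ {a} → Coprime a b → Unique (period b P a)
  period-unique {a} cop = AllPairs.map⁺ (AllPairs.applyUpTo⁺₁ suc P distinct)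
    where
    distinct : ∀ {i j} → i < j → j < P → mod* (a * 2 ^ suc i) b ≢ mod* (a * 2 ^ suc j) b
    distinct {i} {j} i<j j<P eq = <⇒≱ (≤-<-trans (m∸n≤m j i) j<P)
      (proj₂ least (j ∸ i) (m<n⇒0<n∸m i<j , ≡±1⇒±1-residue 2^[j∸i]≡±1))
      where
      2^[j∸i]≡±1 : 2 ^ (j ∸ i) ≡± 1
      2^[j∸i]≡±1 = coprime-cancel (coprime-* cop (coprime-2^ (suc i))) (m^n>0 2 (j ∸ i)) (begin
        a * 2 ^ suc i * 2 ^ (j ∸ i) ≡⟨ *2^-+ a (suc i) (j ∸ i) ⟨
        a * 2 ^ (suc i + (j ∸ i))   ≡⟨ cong (λ e → a * 2 ^ suc e) (m+[n∸m]≡n (<⇒≤ i<j)) ⟩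
        a * 2 ^ suc j               ≈⟨ mod*-injective eq ⟨
        a * 2 ^ suc i               ∎)
        where open ≡±-Reasoning

  periods-disjoint : ∀ {a c} → ¬ a ⇝ c → ∀ x → x ∈ period b P a → x ∉ period b P c
  periods-disjoint {a} {c} ¬a⇝c _ x∈a x∈c =
    ¬a⇝c (⇝-trans (∈period⇒⇝ {a} x∈a) (⇝-sym (∈period⇒⇝ {c} x∈c)))

  odd-seed : ∀ {r} → r ∈ RRS* b → ∃[ o ] o ∈ RRS* b × o % 2 ≡ 1 × o ⇝ r
  odd-seed r∈ with 1≤r , r≤n , cop ← ∈RRS*⁻ r∈
              with o , e , odd , o2^e≡r ← odd-part _ 1≤r =
    o , ∈RRS*⁺ 1≤o (≤-trans o≤r r≤n) (coprime-∣ o∣r cop) , odd , reach e (≡⇒≡± (sym o2^e≡r))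
    where
    1≤o : 1 ≤ o
    1≤o = n≢0⇒n>0 λ { refl → contradiction odd λ () }
    o≤r : o ≤ _
    o≤r = subst (o ≤_) o2^e≡r (m≤m*n o (2 ^ e) {{m^n≢0 2 e}})
    o∣r : o ∣ _
    o∣r = subst (o ∣_) o2^e≡r (m∣m*n (2 ^ e))

  -- Seed generation

  ∈occurred⁻ : ∀ {S x} → x ∈ occurred b P S → ∃[ s ] s ∈ S × x ∈ period b P s
  ∈occurred⁻ {S} x∈ = find (∈-concatMap⁻ (λ a → period b P a) {xs = S} x∈)

  ∈occurred⁺ : ∀ {S s x} → s ∈ S → x ∈ period b P s → x ∈ occurred b P S
  ∈occurred⁺ {S} s∈ x∈ = ∈-concatMap⁺ (λ a → period b P a) {xs = S} (lose s∈ x∈)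

  SeedInvariant : List ℕ → Set
  SeedInvariant S = All (_∈ RRS* b) S × AllPairs (λ a c → ¬ a ⇝ c) S

  Covers : List ℕ → Set
  Covers S = All (_∈ occurred b P S) (RRS* b)

  Complete : List ℕ → Set
  Complete S = SeedInvariant S × Covers S

  Fresh : List ℕ → Maybe ℕ → Set
  Fresh S nothing  = ⊥
  Fresh S (just a) = a ∈ RRS* b × a ∉ occurred b P S

  module FirstOddNew (S : List ℕ) where

    -- The list traversal inside firstOddNew is not exported by Defs; unification
    -- recovers it as search once RRS* b is abstracted.
    mutual
      search : List ℕ → Maybe ℕ
      search = _

      firstOddNew≡search : firstOddNew b P S ≡ search (RRS* b)
      firstOddNew≡search with RRS* b
      ... | _ = refl

    search-fresh : ∀ xs → xs ⊆ RRS* b → ∀ {r} → r ∈ xs → r % 2 ≡ 1 → r ∉ occurred b P S →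
                   Fresh S (search xs)
    search-fresh (x ∷ xs) xs⊆ r∈ odd r∉ with x % 2 ≟ 1 | x ∈? occurred b P S
    ... | yes _ | no x∉ = xs⊆ (here refl) , x∉
    search-fresh (x ∷ xs) xs⊆ (here refl) odd r∉ | no x%2≢1 | _    = contradiction odd x%2≢1
    search-fresh (x ∷ xs) xs⊆ (there r∈)  odd r∉ | no _     | _    =
      search-fresh xs (xs⊆ ∘ there) r∈ odd r∉
    search-fresh (x ∷ xs) xs⊆ (here refl) odd r∉ | yes _    | yes x∈ = contradiction x∈ r∉
    search-fresh (x ∷ xs) xs⊆ (there r∈)  odd r∉ | yes _    | yes _  =
      search-fresh xs (xs⊆ ∘ there) r∈ odd r∉

  firstOddNew-fresh : ∀ S → ¬ Covers S → Fresh S (firstOddNew b P S)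
  firstOddNew-fresh S ¬covered
    with r , r∈ , r∉ ← find (All.¬All⇒Any¬ (_∈? occurred b P S) (RRS* b) ¬covered)
    with o , o∈ , odd , o⇝r ← odd-seed r∈ =
    subst (Fresh S) (sym firstOddNew≡search) (search-fresh (RRS* b) (λ x∈ → x∈) o∈ odd o∉)
    where
    open FirstOddNew S
    o∉ : o ∉ occurred b P S
    o∉ o∈occ with s , s∈ , o∈s ← ∈occurred⁻ {S} o∈occ =
      r∉ (∈occurred⁺ s∈ (⇝⇒∈period (∈RRS*⇒≤n r∈) (⇝-trans (∈period⇒⇝ {s} o∈s) o⇝r)))

  seedInvariant-∷ʳ : ∀ {S a} → SeedInvariant S → a ∈ RRS* b → a ∉ occurred b P S →
                     SeedInvariant (S ++ [ a ])
  seedInvariant-∷ʳ {S} (S⊆RRS* , S!) a∈ a∉ =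
    All.++⁺ S⊆RRS* (a∈ ∷ []) ,
    AllPairs.++⁺ S! ([] ∷ [])
      (All.tabulate λ s∈ → (λ s⇝a → a∉ (∈occurred⁺ s∈ (⇝⇒∈period (∈RRS*⇒≤n a∈) s⇝a))) ∷ [])

  missing-∷ʳ : ∀ {S a} → a ∈ RRS* b → a ∉ occurred b P S →
               missing (occurred b P (S ++ [ a ])) (RRS* b) < missing (occurred b P S) (RRS* b)
  missing-∷ʳ {S} {a} a∈ a∉ = missing-< (RRS* b) grow a∈ a∉
    (∈occurred⁺ (∈-++⁺ʳ S (here refl)) (⇝⇒∈period (∈RRS*⇒≤n a∈) (⇝-refl {a})))
    where
    grow : occurred b P S ⊆ occurred b P (S ++ [ a ])
    grow x∈ with s , s∈ , x∈s ← ∈occurred⁻ {S} x∈ = ∈occurred⁺ (∈-++⁺ˡ s∈) x∈s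

  firstOddNew-just : ∀ S → ¬ Covers S →
                     ∃[ a ] firstOddNew b P S ≡ just a × a ∈ RRS* b × a ∉ occurred b P S
  firstOddNew-just S ¬covered = extract (firstOddNew b P S) refl (firstOddNew-fresh S ¬covered)
    where
    extract : ∀ m → firstOddNew b P S ≡ m → Fresh S m →
              ∃[ a ] firstOddNew b P S ≡ just a × a ∈ RRS* b × a ∉ occurred b P S
    extract (just a) eq (a∈ , a∉) = a , eq , a∈ , a∉

  addSeeds-done : ∀ f S → Covers S → addSeeds b P (suc f) S ≡ S
  addSeeds-done f S covered with all? (_∈? occurred b P S) (RRS* b)
  ... | yes _         = refl
  ... | no  ¬covered = contradiction covered ¬covered

  addSeeds-step : ∀ f S {a} → ¬ Covers S → firstOddNew b P S ≡ just a →
                  addSeeds b P (suc f) S ≡ addSeeds b P f (S ++ [ a ])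
  addSeeds-step f S ¬covered eq with all? (_∈? occurred b P S) (RRS* b)
  ... | yes covered = contradiction covered ¬covered
  ... | no  _ with firstOddNew b P S | eq
  ...   | just _ | refl = refl

  addSeeds-correct : ∀ f S → SeedInvariant S → missing (occurred b P S) (RRS* b) ≤ f →
                     Complete (addSeeds b P f S)
  addSeeds-correct zero    S inv m≤0   = inv , missing≡0⇒All∈ (RRS* b) (n≤0⇒n≡0 m≤0)
  addSeeds-correct (suc f) S inv m≤1+f = case all? (_∈? occurred b P S) (RRS* b) of λ where
    (yes covered) → subst Complete (sym (addSeeds-done f S covered)) (inv , covered)
    (no ¬covered) → let a , eq , a∈ , a∉ = firstOddNew-just S ¬covered in
      subst Complete (sym (addSeeds-step f S ¬covered eq))
        (addSeeds-correct f (S ++ [ a ]) (seedInvariant-∷ʳ inv a∈ a∉)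
          (≤-pred (<-≤-trans (missing-∷ʳ {S} a∈ a∉) m≤1+f)))

  seeds-correct : Complete (seeds b P)
  seeds-correct = addSeeds-correct b [ 1 ] ((1∈RRS* n≥1 ∷ []) , ([] ∷ [])) (begin
    missing (occurred b P [ 1 ]) (RRS* b) ≤⟨ missing≤length _ (RRS* b) ⟩
    length (RRS* b)                       ≤⟨ length-filter reduced? (upTo b) ⟩
    length (upTo b)                       ≡⟨ length-upTo b ⟩
    b                                     ∎)
    where open ≤-Reasoning

  seed-coprime : ∀ {s} → s ∈ seeds b P → Coprime s b
  seed-coprime s∈ = proj₂ (proj₂ (∈RRS*⁻ (All.lookup (proj₁ (proj₁ seeds-correct)) s∈)))

  IcoS-lengths : All (λ per → length per ≡ P) (IcoS b P)
  IcoS-lengths = All.map⁺ (All.tabulate λ {a} _ → length-period a)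

  IcoS-disjoint : AllPairs (λ X Y → ∀ j → j ∈ X → j ∉ Y) (IcoS b P)
  IcoS-disjoint = AllPairs.map⁺ (AllPairs.map periods-disjoint (proj₂ (proj₁ seeds-correct)))

  concat-IcoS↭RRS* : concat (IcoS b P) ↭ RRS* b
  concat-IcoS↭RRS* = unique∧set⇒↭ concat-unique RRS*-unique
    (mk⇔ concat⊆RRS* (All.lookup (proj₂ seeds-correct)))
    where
    concat-unique : Unique (concat (IcoS b P))
    concat-unique = Unique.concat⁺
      (All.map⁺ (All.tabulate (period-unique ∘ seed-coprime)))
      (AllPairs.map⁺ (AllPairs.map (λ ¬a⇝c {x} (x∈a , x∈c) → periods-disjoint ¬a⇝c x x∈a x∈c)
                                   (proj₂ (proj₁ seeds-correct))))
    concat⊆RRS* : concat (IcoS b P) ⊆ RRS* b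
    concat⊆RRS* x∈ with s , s∈ , x∈s ← ∈occurred⁻ {seeds b P} x∈ = period⊆RRS* (seed-coprime s∈) x∈s

  length-IcoS : length (IcoS b P) * (2 * P) ≡ φ b
  length-IcoS = begin
    length (IcoS b P) * (2 * P)    ≡⟨ x∙yz≈y∙xz (length (IcoS b P)) 2 P ⟩
    2 * (length (IcoS b P) * P)    ≡⟨ cong (2 *_) (length-concat-const P IcoS-lengths) ⟨
    2 * length (concat (IcoS b P)) ≡⟨ cong (2 *_) (↭-length concat-IcoS↭RRS*) ⟩
    2 * length (RRS* b)            ≡⟨ φ≡2*|RRS*| n≥1 ⟨
    φ b                            ∎
    where open ≡-Reasoning

theorem22 : (n P : ℕ) → 1 ≤ n → IsLeastPeriodLength (suc (2 * n)) P →
    (length (IcoS (suc (2 * n)) P) * (2 * P) ≡ φ (suc (2 * n)))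
    × All (λ per → length per ≡ P) (IcoS (suc (2 * n)) P)
    × AllPairs (λ X Y → ∀ j → j ∈ X → j ∉ Y) (IcoS (suc (2 * n)) P)
    × (concat (IcoS (suc (2 * n)) P) ↭ RRS* (suc (2 * n)))
theorem22 n zero    _   ((() , _) , _)
theorem22 n (suc p) n≥1 least = length-IcoS , IcoS-lengths , IcoS-disjoint , concat-IcoS↭RRS*
  where open Periods n p n≥1 least
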